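{- Let $p=4k+1$ be a prime. If there exist an integer $t\ge 0$ and positive integers $a,b$ with $ab\mid k+1+t$ and $a+b=3+4t$, then $0\le t\le\left\lfloor\frac{k-1}{3}\right\rfloor$. -}

module Defs where

{-# OPTIONS --safe #-}
-- Since a, b ≥ 1, (a − 1)(b − 1) ≥ 0 gives a + b ≤ ab + 1, and ab ∣ k + 1 + t
-- gives ab ≤ k + 1 + t. With a + b = 3 + 4t this yields 3t + 1 ≤ k.
module Submission where

open import Defs
open import Data.Nat using (ℕ; _+_; _*_; _∸_; _≤_; _<_; suc; z≤n; NonZero; >-nonZero)
open import Data.Nat.Divisibility using (_∣_; ∣⇒≤)
open import Data.Nat.DivMod using (_/_; /-monoˡ-≤; m*n/n≡m)
open import Data.Nat.Primality using (Prime)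
open import Data.Nat.Properties
  using (≤-trans; m≤n+m; m≤m+n; +-monoˡ-≤; +-cancelˡ-≤; m+n≤o⇒m≤o∸n; module ≤-Reasoning)
open import Data.Nat.Tactic.RingSolver using (solve-∀)
open import Data.Product using (_×_; _,_)
open import Relation.Binary.PropositionalEquality using (_≡_; sym; subst₂)

m+n≤m*n+1 : ∀ {m n} → 0 < m → 0 < n → m + n ≤ m * n + 1
m+n≤m*n+1 {suc a} {suc b} _ _ = begin
  suc a + suc b            ≤⟨ m≤n+m (suc a + suc b) (a * b) ⟩
  a * b + (suc a + suc b)  ≡⟨ expand a b ⟩
  suc a * suc b + 1        ∎
  where
  open ≤-Reasoning
  expand : ∀ a b → a * b + (suc a + suc b) ≡ suc a * suc b + 1
  expand = solve-∀

m*n≤o⇒m≤o/n : ∀ m n o .{{_ : NonZero n}} → m * n ≤ o → m ≤ o / n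
m*n≤o⇒m≤o/n m n o m*n≤o = begin
  m          ≡⟨ sym (m*n/n≡m m n) ⟩
  m * n / n  ≤⟨ /-monoˡ-≤ n m*n≤o ⟩
  o / n      ∎
  where open ≤-Reasoning

3+4t≤k+t+2⇒3t≤k∸1 : ∀ k t → 3 + 4 * t ≤ k + 1 + t + 1 → t * 3 ≤ k ∸ 1
3+4t≤k+t+2⇒3t≤k∸1 k t le =
  m+n≤o⇒m≤o∸n (t * 3) (+-cancelˡ-≤ (t + 2) _ _ (subst₂ _≤_ (lhs t) (rhs k t) le))
  where
  lhs : ∀ t → 3 + 4 * t ≡ t + 2 + (t * 3 + 1)
  lhs = solve-∀
  rhs : ∀ k t → k + 1 + t + 1 ≡ t + 2 + k
  rhs = solve-∀

proposition4 : (k : ℕ) → Prime (4 * k + 1) → (t a b : ℕ) → 0 < a → 0 < b → (a * b) ∣ (k + 1 + t) → a + b ≡ 3 + 4 * t → 0 ≤ t × t ≤ (k ∸ 1) / 3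
proposition4 k _ t a b 0<a 0<b ab∣k+1+t a+b≡3+4t =
  z≤n , m*n≤o⇒m≤o/n t 3 (k ∸ 1) (3+4t≤k+t+2⇒3t≤k∸1 k t 3+4t≤k+t+2)
  where
  open ≤-Reasoning
  instance
    k+1+t≢0 : NonZero (k + 1 + t)
    k+1+t≢0 = >-nonZero (≤-trans (m≤n+m 1 k) (m≤m+n (k + 1) t))
  3+4t≤k+t+2 : 3 + 4 * t ≤ k + 1 + t + 1
  3+4t≤k+t+2 = begin
    3 + 4 * t      ≡⟨ sym a+b≡3+4t ⟩
    a + b          ≤⟨ m+n≤m*n+1 0<a 0<b ⟩
    a * b + 1      ≤⟨ +-monoˡ-≤ 1 (∣⇒≤ ab∣k+1+t) ⟩
    k + 1 + t + 1  ∎
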